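{- (Generation lemma on abstractions.) Let $g:\mathbb N\to\mathbb N$ satisfy $h<g(h)$ for all $h$. For every environment $C$, variable $x$ and terms $V,U_1,T$: if $C\vdash_g \lambda x{:}V.U_1:T$, then there exist terms $U_2,U$ such that $C\vdash \lambda x{:}V.U_2\Leftrightarrow T$, $C\vdash_g V:U$ and $C.\lambda x{:}V\vdash_g U_1:U_2$.
   Context: Terms of $\lambda\delta$: $T ::= \ast h \mid x \mid \lambda x{:}W.\,T \mid \delta x{=}V.\,T \mid \mathrm{appl}(V,T) \mid \mathrm{cast}(W,T)$ ($h\in\mathbb N$, $x$ a variable); $\ast h$ is a sort, $\lambda x{:}W.T$ abstraction over type $W$, $\delta x{=}V.T$ the abbreviation "let $x=V$ in $T$", $\mathrm{appl}(V,T)$ application of $T$ to argument $V$, $\mathrm{cast}(W,T)$ $T$ annotated with type $W$. In $\lambda x{:}W.T$, $\delta x{=}V.T$, $x$ is bound in $T$ only; $\mathrm{FV}(T)$ free variables; terms up to renaming of bound variables with bound and free names disjoint. Environments: $E ::= \ast h \mid \lambda x{:}W.E \mid \delta x{=}V.E \mid \mathrm{appl}(V,E)\mid\mathrm{cast}(W,E)$. $E.\lambda x{:}W$ (resp. $E.\delta x{=}V$) is $E$ with its terminal sort $\ast h$ replaced by $\lambda x{:}W.\ast h$ (resp. $\delta x{=}V.\ast h$). $E=C_1\cdot\beta\cdot C_2$, for an item $\beta$ of the form $\lambda x{:}W$ or $\delta x{=}V$, means $E$ is obtained from the environment $C_1$ by replacing its terminal sort with $\beta.C_2$ for some environment $C_2$.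 Strict substitution: $T[x:=^+W]\,T'$ iff $x\notin\mathrm{FV}(W)$, $x\in\mathrm{FV}(T)$ and $T'$ arises from $T$ by replacing a nonempty set of free occurrences of $x$ by $W$. Environment-free parallel reduction $\to_0$: least relation closed under (refl) $T\to_0T$; (compatibility) if $A_1\to_0A_2$, $T_1\to_0T_2$ then $\lambda x{:}A_1.T_1\to_0\lambda x{:}A_2.T_2$, $\delta x{=}A_1.T_1\to_0\delta x{=}A_2.T_2$, $\mathrm{appl}(A_1,T_1)\to_0\mathrm{appl}(A_2,T_2)$, $\mathrm{cast}(A_1,T_1)\to_0\mathrm{cast}(A_2,T_2)$; ($\beta$) if $V_1\to_0V_2$, $T_1\to_0T_2$ then $\mathrm{appl}(V_1,\lambda x{:}W.T_1)\to_0\delta x{=}V_2.T_2$; ($\delta$) if $V_1\to_0V_2$, $T_1\to_0T_2$, $T_2[x:=^+V_2]T$ then $\delta x{=}V_1.T_1\to_0\delta x{=}V_2.T$; ($\zeta$) if $T_1\to_0T_2$, $x\notin\mathrm{FV}(T_1)$ then $\delta x{=}V.T_1\to_0T_2$; ($\tau$) if $T_1\to_0T_2$ then $\mathrm{cast}(W,T_1)\to_0T_2$; ($\upsilon$) if $V_1\to_0V_3$, $V_2\to_0V_4$, $T_1\to_0T_2$ then $\mathrm{appl}(V_1,\delta x{=}V_2.T_1)\to_0\delta x{=}V_4.\mathrm{appl}(V_3,T_2)$. $E\vdash T_1\to T_2$ iff $T_1\to_0T_2$, or $E=C_1\cdot\delta x{=}V\cdot C_2$, $T_1\to_0T'$,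 $T'[x:=^+V]T_2$. Conversion $E\vdash T_1\Leftrightarrow T_2$ is its symmetric and transitive closure. Native type assignment $E\vdash_g T:U$ is the least relation closed under: (sort) $E\vdash_g\ast h:\ast g(h)$; (def) if $E=C_1\cdot\delta x{=}V\cdot C_2$ and $C_1\vdash_g V:W$ then $E\vdash_g x:W$; (decl) if $E=C_1\cdot\lambda x{:}W\cdot C_2$ and $C_1\vdash_g W:V$ then $E\vdash_g x:W$; (abbr) if $E\vdash_g V:W$ and $E.\delta x{=}V\vdash_g T:U$ then $E\vdash_g\delta x{=}V.T:\delta x{=}V.U$; (abst) if $E\vdash_g W:V$ and $E.\lambda x{:}W\vdash_g T:U$ then $E\vdash_g\lambda x{:}W.T:\lambda x{:}W.U$; (appl) if $E\vdash_g V:W$ and $E\vdash_g T:\lambda x{:}W.U$ then $E\vdash_g\mathrm{appl}(V,T):\mathrm{appl}(V,\lambda x{:}W.U)$; (cast) if $E\vdash_g T:W$ and $E\vdash_g W:V$ then $E\vdash_g\mathrm{cast}(W,T):\mathrm{cast}(V,W)$; (conv) if $E\vdash_g U_2:W$, $E\vdash_g T:U_1$ and $E\vdash U_1\Leftrightarrow U_2$ then $E\vdash_g T:U_2$. -}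

module Defs where

-- The λδ calculus with de Bruijn indices (terms up to α-renaming).
-- A variable is a natural number: index i refers to the i-th enclosing
-- binder (λ or δ), counting from the innermost one (index 0).

open import Data.Nat using (ℕ; zero; suc; _+_; _<ᵇ_)
open import Data.Bool using (if_then_else_)
open import Relation.Binary.PropositionalEquality using (_≡_)
open import Relation.Binary.Construct.Closure.Equivalence using (EqClosure)

data Term : Set where
  sort : ℕ → Term
  var  : ℕ → Term
  lam  : Term → Term → Term       -- lam W T  =  λx:W.T
  abbr : Term → Term → Term       -- abbr V T =  δx=V.T
  appl : Term → Term → Term       -- appl V T =  appl(V,T)
  cast : Term → Term → Term       -- cast W T =  cast(W,T)

lift : ℕ → ℕ → Term → Term
lift d k (sort h) = sort h
lift d k (var i) = if i <ᵇ d then var i else var (i + k)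
lift d k (lam W T) = lam (lift d k W) (lift (suc d) k T)
lift d k (abbr V T) = abbr (lift d k V) (lift (suc d) k T)
lift d k (appl V T) = appl (lift d k V) (lift d k T)
lift d k (cast W T) = cast (lift d k W) (lift d k T)

-- SSub d W T T' : T' arises from T by replacing a NONEMPTY set of free
-- occurrences of the variable with index d by W (W given in the scope
-- of T; under a binder d is incremented and W lifted).
-- In every use below W is a lifted term in which index d is not free,
-- so the side condition x ∉ FV(W) is automatic, and x ∈ FV(T) follows
-- from non-emptiness.

data SSub : ℕ → Term → Term → Term → Set
data Sub : ℕ → Term → Term → Term → Set

data Sub where
  sub-none : ∀ {d W T} → Sub d W T T
  sub-some : ∀ {d W T T'} → SSub d W T T' → Sub d W T T'

data SSub where
  ss-var   : ∀ {d W} → SSub d W (var d) W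
  ss-lamˡ  : ∀ {d W A A' T T'} → SSub d W A A' → Sub (suc d) (lift 0 1 W) T T' → SSub d W (lam A T) (lam A' T')
  ss-lamʳ  : ∀ {d W A A' T T'} → Sub d W A A' → SSub (suc d) (lift 0 1 W) T T' → SSub d W (lam A T) (lam A' T')
  ss-abbrˡ : ∀ {d W A A' T T'} → SSub d W A A' → Sub (suc d) (lift 0 1 W) T T' → SSub d W (abbr A T) (abbr A' T')
  ss-abbrʳ : ∀ {d W A A' T T'} → Sub d W A A' → SSub (suc d) (lift 0 1 W) T T' → SSub d W (abbr A T) (abbr A' T')
  ss-applˡ : ∀ {d W A A' T T'} → SSub d W A A' → Sub d W T T' → SSub d W (appl A T) (appl A' T')
  ss-applʳ : ∀ {d W A A' T T'} → Sub d W A A' → SSub d W T T' → SSub d W (appl A T) (appl A' T')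
  ss-castˡ : ∀ {d W A A' T T'} → SSub d W A A' → Sub d W T T' → SSub d W (cast A T) (cast A' T')
  ss-castʳ : ∀ {d W A A' T T'} → Sub d W A A' → SSub d W T T' → SSub d W (cast A T) (cast A' T')

infix 4 _⇒₀_

data _⇒₀_ : Term → Term → Set where
  r-refl : ∀ {T} → T ⇒₀ T
  r-lam  : ∀ {A₁ A₂ T₁ T₂} → A₁ ⇒₀ A₂ → T₁ ⇒₀ T₂ → lam A₁ T₁ ⇒₀ lam A₂ T₂
  r-abbr : ∀ {A₁ A₂ T₁ T₂} → A₁ ⇒₀ A₂ → T₁ ⇒₀ T₂ → abbr A₁ T₁ ⇒₀ abbr A₂ T₂
  r-appl : ∀ {A₁ A₂ T₁ T₂} → A₁ ⇒₀ A₂ → T₁ ⇒₀ T₂ → appl A₁ T₁ ⇒₀ appl A₂ T₂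
  r-cast : ∀ {A₁ A₂ T₁ T₂} → A₁ ⇒₀ A₂ → T₁ ⇒₀ T₂ → cast A₁ T₁ ⇒₀ cast A₂ T₂
  r-β    : ∀ {V₁ V₂ W T₁ T₂} → V₁ ⇒₀ V₂ → T₁ ⇒₀ T₂ → appl V₁ (lam W T₁) ⇒₀ abbr V₂ T₂
  -- (δ): x is index 0 in the body, V₂ is lifted into the body's scope
  r-δ    : ∀ {V₁ V₂ T₁ T₂ T} → V₁ ⇒₀ V₂ → T₁ ⇒₀ T₂ → SSub 0 (lift 0 1 V₂) T₂ T → abbr V₁ T₁ ⇒₀ abbr V₂ T
  -- (ζ): x ∉ FV(T₁) means T₁ is a lifted term; the result lives outside the binder
  r-ζ    : ∀ {V T₁ T₂} → T₁ ⇒₀ T₂ → abbr V (lift 0 1 T₁) ⇒₀ T₂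
  r-τ    : ∀ {W T₁ T₂} → T₁ ⇒₀ T₂ → cast W T₁ ⇒₀ T₂
  r-υ    : ∀ {V₁ V₂ V₃ V₄ T₁ T₂} → V₁ ⇒₀ V₃ → V₂ ⇒₀ V₄ → T₁ ⇒₀ T₂ → appl V₁ (abbr V₂ T₁) ⇒₀ abbr V₄ (appl (lift 0 1 V₃) T₂)

data Env : Set where
  sortE : ℕ → Env
  lamE  : Term → Env → Env
  abbrE : Term → Env → Env
  applE : Term → Env → Env
  castE : Term → Env → Env

plug : Env → Env → Env
plug (sortE h) F = F
plug (lamE W C) F = lamE W (plug C F)
plug (abbrE V C) F = abbrE V (plug C F)
plug (applE V C) F = applE V (plug C F)
plug (castE W C) F = castE W (plug C F)

tsort : Env → ℕ
tsort (sortE h) = h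
tsort (lamE _ C) = tsort C
tsort (abbrE _ C) = tsort C
tsort (applE _ C) = tsort C
tsort (castE _ C) = tsort C

bnd : Env → ℕ
bnd (sortE h) = 0
bnd (lamE _ C) = suc (bnd C)
bnd (abbrE _ C) = suc (bnd C)
bnd (applE _ C) = bnd C
bnd (castE _ C) = bnd C

_∙λ_ : Env → Term → Env
E ∙λ W = plug E (lamE W (sortE (tsort E)))

_∙δ_ : Env → Term → Env
E ∙δ V = plug E (abbrE V (sortE (tsort E)))

-- C₁·λx:W·C₂  and  C₁·δx=V·C₂ ; the variable x of such a
-- decomposition of E is the index bnd C₂, and a term living in C₁
-- is transported into E by lift 0 (suc (bnd C₂)).
_·λ_·_ : Env → Term → Env → Env
C₁ ·λ W · C₂ = plug C₁ (lamE W C₂)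

_·δ_·_ : Env → Term → Env → Env
C₁ ·δ V · C₂ = plug C₁ (abbrE V C₂)

data Red (E : Env) : Term → Term → Set where
  red₀ : ∀ {T₁ T₂} → T₁ ⇒₀ T₂ → Red E T₁ T₂
  redδ : ∀ {C₁ V C₂ T₁ T' T₂} → E ≡ C₁ ·δ V · C₂ → T₁ ⇒₀ T' →
         SSub (bnd C₂) (lift 0 (suc (bnd C₂)) V) T' T₂ → Red E T₁ T₂

Conv : Env → Term → Term → Set
Conv E = EqClosure (Red E)

data Typ (g : ℕ → ℕ) : Env → Term → Term → Set where
  t-sort : ∀ {E h} → Typ g E (sort h) (sort (g h))
  t-def  : ∀ {E C₁ V C₂ W} → E ≡ C₁ ·δ V · C₂ → Typ g C₁ V W →
           Typ g E (var (bnd C₂)) (lift 0 (suc (bnd C₂)) W)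
  t-decl : ∀ {E C₁ W C₂ V} → E ≡ C₁ ·λ W · C₂ → Typ g C₁ W V →
           Typ g E (var (bnd C₂)) (lift 0 (suc (bnd C₂)) W)
  t-abbr : ∀ {E V W T U} → Typ g E V W → Typ g (E ∙δ V) T U →
           Typ g E (abbr V T) (abbr V U)
  t-abst : ∀ {E W V T U} → Typ g E W V → Typ g (E ∙λ W) T U →
           Typ g E (lam W T) (lam W U)
  t-appl : ∀ {E V W T U} → Typ g E V W → Typ g E T (lam W U) →
           Typ g E (appl V T) (appl V (lam W U))
  t-cast : ∀ {E T W V} → Typ g E T W → Typ g E W V →
           Typ g E (cast W T) (cast V W)
  t-conv : ∀ {E U₂ W T U₁} → Typ g E U₂ W → Typ g E T U₁ → Conv E U₁ U₂ →
           Typ g E T U₂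

{-# OPTIONS --safe #-}
module Submission where

open import Defs
open import Data.Nat using (ℕ; _<_)
open import Data.Product using (Σ; _×_; _,_)
open import Relation.Binary.Construct.Closure.ReflexiveTransitive using (ε; _◅◅_)

Typ-lam-inversion : ∀ {g C V U₁ T} → Typ g C (lam V U₁) T →
                    Σ Term (λ U₂ → Σ Term (λ U →
                      Conv C (lam V U₂) T × Typ g C V U × Typ g (C ∙λ V) U₁ U₂))
Typ-lam-inversion (t-abst {U = U₂} ⊢V ⊢U₁) = U₂ , _ , ε , ⊢V , ⊢U₁
Typ-lam-inversion (t-conv _ ⊢lam T′⇔T) with Typ-lam-inversion ⊢lam
... | U₂ , U , lam⇔T′ , ⊢V , ⊢U₁ = U₂ , U , lam⇔T′ ◅◅ T′⇔T , ⊢V , ⊢U₁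

mainTheorem10 : (g : ℕ → ℕ) → (∀ h → h < g h) →
                ∀ (C : Env) (V U₁ T : Term) → Typ g C (lam V U₁) T →
                Σ Term (λ U₂ → Σ Term (λ U →
                  Conv C (lam V U₂) T × Typ g C V U × Typ g (C ∙λ V) U₁ U₂))
mainTheorem10 g _ C V U₁ T ⊢lam = Typ-lam-inversion ⊢lam
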